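{- Let $c\in\mathbb{L}$, $A\subseteq\mathbb{L}\setminus\{c\}$, and let $f\colon\mathbb{L}\to\mathbb{L}$ behave as $\mathrm{rer}_c$ on $A$. Then $f$ preserves $Q$ on $A\cup\{c\}$.
   Context: A finite rooted binary tree is a finite rooted tree in which every non-leaf vertex has exactly two children; its leaf structure is the structure on its set of leaves with the ternary relation $C$ where $C(x;yz)$ holds iff the youngest common ancestor of $y$ and $z$ is a proper descendant of the youngest common ancestor of $x,y,z$ (so $C(x;yy)$ holds whenever $x\neq y$). $(\mathbb{L};C)$ denotes the unique (up to isomorphism) countable homogeneous structure whose finite substructures are, up to isomorphism, exactly the leaf structures of finite rooted binary trees. We write $xy|z$ for $C(z;xy)$; $a_1\dots a_m|b_1\dots b_n$ (resp. $X|Y$ for sets) means $a_ia_j|b_k$ and $b_kb_l|a_i$ for all $i,j,k,l$ (resp. all choices from $X,Y$). $Q$ is the quaternary relation $xy:uv\iff(xy|u\wedge xy|v)\vee(x|uv\wedge y|uv)$; $f$ preserves $Q$ on $Y$ if $a_1a_2:a_3a_4$ implies $f(a_1)f(a_2):f(a_3)f(a_4)$ for all $a_i\in Y$. For $x\neq c$, $S^c_x=\{y\in\mathbb{L}\setminus\{c\}:xy|c\}$. $e$ preserves $C$ on $B$ if $C(x;yz)$ implies $C(e(x);e(y)e(z))$ for $x,y,z\in B$. $e$ behaves as $\mathrm{rer}_c$ on $A$ if (1) $e(c)|e(A\cap S^c_a)$ for every $a\in A$, (2) $e$ preserves $C$ on $A\cap S^c_a$ for every $a\in A$, (3) for all $a,b\in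 A$ either $S^c_a=S^c_b$ or $e(A\cap S^c_a)|e(A\cap S^c_b)$, and (4) for all $x,y,z\in A$ with $x|yzc$ and $y|zc$: $e(x)e(y)e(z)|e(c)$ and $e(x)e(y)|e(z)$. -}

module Defs where

open import Data.Nat using (ℕ)
open import Data.Product using (Σ; ∃; _×_; _,_)
open import Data.Sum using (_⊎_)
open import Relation.Binary.PropositionalEquality using (_≡_; _≢_)
open import Relation.Nullary using (¬_)

-- An axiomatic presentation of (𝕃; C).  C x y z  encodes  C(x;yz).
record LStructure : Set₁ where
  field
    Carrier : Set
    C       : Carrier → Carrier → Carrier → Set
    C-sym   : ∀ {x y z} → C x y z → C x z y
    C-asym  : ∀ {x y z} → C x y z → ¬ C y x z
    C-trans : ∀ {x y z} w → C x y z → C x w z ⊎ C w y z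
    C-refl  : ∀ {x y} → x ≢ y → C x y y
    -- binary branching (finite substructures are leaf structures of binary trees)
    C-binary : ∀ {x y z} → x ≢ y → y ≢ z → x ≢ z → C x y z ⊎ C y x z ⊎ C z x y
    C-dense : ∀ {x y z} → C x y z → ∃ λ w → C w y z × C x w y
    twoPoints : Σ Carrier λ a → Σ Carrier λ b → a ≢ b
    enc       : Carrier → ℕ
    enc-inj   : ∀ {x y} → enc x ≡ enc y → x ≡ y

module _ (𝕃 : LStructure) where
  open LStructure 𝕃

  _∙_∣_ : Carrier → Carrier → Carrier → Set
  x ∙ y ∣ z = C z x y

  Pred : Set₁
  Pred = Carrier → Set

  _∣∣_ : Pred → Pred → Set
  X ∣∣ Y = ∀ a a' b b' → X a → X a' → Y b → Y b' → (a ∙ a' ∣ b) × (b ∙ b' ∣ a)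

  ⟦_⟧₁ : Carrier → Pred
  ⟦ x ⟧₁ w = w ≡ x
  ⟦_,_⟧₂ : Carrier → Carrier → Pred
  ⟦ x , y ⟧₂ w = w ≡ x ⊎ w ≡ y
  ⟦_,_,_⟧₃ : Carrier → Carrier → Carrier → Pred
  ⟦ x , y , z ⟧₃ w = w ≡ x ⊎ w ≡ y ⊎ w ≡ z

  _∩_ : Pred → Pred → Pred
  (X ∩ Y) w = X w × Y w
  Img : (Carrier → Carrier) → Pred → Pred
  Img e X w = ∃ λ v → X v × e v ≡ w

  S : Carrier → Carrier → Pred
  S c x y = y ≢ c × (x ∙ y ∣ c)

  Q : Carrier → Carrier → Carrier → Carrier → Set
  Q x y u v = ((x ∙ y ∣ u) × (x ∙ y ∣ v)) ⊎ ((u ∙ v ∣ x) × (u ∙ v ∣ y))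

  PreservesQ : (Carrier → Carrier) → Pred → Set
  PreservesQ f Y = ∀ a₁ a₂ a₃ a₄ → Y a₁ → Y a₂ → Y a₃ → Y a₄ →
    Q a₁ a₂ a₃ a₄ → Q (f a₁) (f a₂) (f a₃) (f a₄)

  PreservesC : (Carrier → Carrier) → Pred → Set
  PreservesC e B = ∀ x y z → B x → B y → B z → C x y z → C (e x) (e y) (e z)

  SameSet : Pred → Pred → Set
  SameSet X Y = ∀ w → (X w → Y w) × (Y w → X w)

  record BehavesAsRer (e : Carrier → Carrier) (c : Carrier) (A : Pred) : Set where
    field
      rer1 : ∀ a → A a → ⟦ e c ⟧₁ ∣∣ Img e (A ∩ S c a)
      rer2 : ∀ a → A a → PreservesC e (A ∩ S c a)
      rer3 : ∀ a b → A a → A b →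
               SameSet (S c a) (S c b) ⊎ (Img e (A ∩ S c a) ∣∣ Img e (A ∩ S c b))
      rer4 : ∀ x y z → A x → A y → A z →
               ⟦ x ⟧₁ ∣∣ ⟦ y , z , c ⟧₃ → ⟦ y ⟧₁ ∣∣ ⟦ z , c ⟧₂ →
               (⟦ e x , e y , e z ⟧₃ ∣∣ ⟦ e c ⟧₁) × (⟦ e x , e y ⟧₂ ∣∣ ⟦ e z ⟧₁)

-- Whether a b : c d holds is decided by the relative position of the four points
-- with respect to c.  For points of A the rer-conditions determine where f sends
-- each such configuration: inside one branch S^c_a the map preserves C (2), two
-- different branches are mapped apart (3), the image of c stays outside the image
-- of every branch (1), and points lined up on the way towards c keep their order
-- (4).  So every instance of Q among A ∪ {c} is reduced to one of these cases.
module Submission where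

open import Defs
import Data.Nat as ℕ
open import Data.Product using (_×_; _,_; proj₁; proj₂)
open import Data.Sum using (_⊎_; inj₁; inj₂)
open import Data.Empty using (⊥-elim)
open import Relation.Nullary using (¬_; Dec; yes; no)
open import Relation.Binary.PropositionalEquality using (_≡_; _≢_; refl; sym; cong)

module CProperties (𝕃 : LStructure) where
  open LStructure 𝕃

  C-irreflˡ : ∀ {x z} → ¬ C x x z
  C-irreflˡ h = C-asym h h

  C-irreflʳ : ∀ {x y} → ¬ C x y x
  C-irreflʳ h = C-irreflˡ (C-sym h)

  C⇒≢ˡ : ∀ {x y z} → C x y z → x ≢ y
  C⇒≢ˡ h refl = C-irreflˡ h

  C⇒≢ʳ : ∀ {x y z} → C x y z → x ≢ z
  C⇒≢ʳ h refl = C-irreflʳ h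

  _≟_ : (x y : Carrier) → Dec (x ≡ y)
  x ≟ y with enc x ℕ.≟ enc y
  ... | yes e = yes (enc-inj e)
  ... | no ne = no (λ e → ne (cong enc e))

  C? : ∀ x y z → Dec (C x y z)
  C? x y z with x ≟ y | x ≟ z | y ≟ z
  ... | yes refl | _      | _        = no C-irreflˡ
  ... | no _     | yes refl | _      = no C-irreflʳ
  ... | no x≢y   | no x≢z | yes refl = yes (C-refl x≢y)
  ... | no x≢y   | no x≢z | no y≢z with C-binary x≢y y≢z x≢z
  ...   | inj₁ h         = yes h
  ...   | inj₂ (inj₁ h)  = no (C-asym h)
  ...   | inj₂ (inj₂ h)  = no (λ h′ → C-asym (C-sym h′) h)

  C-nest : ∀ {a b d e} → C a b e → C b d e → C a b d
  C-nest {d = d} be∣a de∣b with C-trans d (C-sym be∣a)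
  ... | inj₁ h = C-sym h
  ... | inj₂ h = ⊥-elim (C-asym de∣b (C-sym h))

  Q-swapˡ : ∀ {x y u v} → Q 𝕃 x y u v → Q 𝕃 y x u v
  Q-swapˡ (inj₁ (p , q)) = inj₁ (C-sym p , C-sym q)
  Q-swapˡ (inj₂ (p , q)) = inj₂ (q , p)

  Q-swapʳ : ∀ {x y u v} → Q 𝕃 x y u v → Q 𝕃 x y v u
  Q-swapʳ (inj₁ (p , q)) = inj₁ (q , p)
  Q-swapʳ (inj₂ (p , q)) = inj₂ (C-sym p , C-sym q)

  Q-flip : ∀ {x y u v} → Q 𝕃 x y u v → Q 𝕃 u v x y
  Q-flip (inj₁ p) = inj₂ p
  Q-flip (inj₂ p) = inj₁ p

  singleton-∣∣ : ∀ {x} {Y : Pred 𝕃} → (∀ {b b′} → Y b → Y b′ → C x b b′) →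
                 _∣∣_ 𝕃 (⟦_⟧₁ 𝕃 x) Y
  singleton-∣∣ sep _ _ b b′ refl refl Yb Yb′ =
    C-refl (λ b≡x → C⇒≢ˡ (sep Yb Yb) (sym b≡x)) , sep Yb Yb′

  singleton-∣∣-pair : ∀ {x y z} → C x y z → _∣∣_ 𝕃 (⟦_⟧₁ 𝕃 x) (⟦_,_⟧₂ 𝕃 y z)
  singleton-∣∣-pair {x} {y} {z} yz∣x = singleton-∣∣ sep
    where
    sep : ∀ {b b′} → b ≡ y ⊎ b ≡ z → b′ ≡ y ⊎ b′ ≡ z → C x b b′
    sep (inj₁ refl) (inj₁ refl) = C-refl (C⇒≢ˡ yz∣x)
    sep (inj₁ refl) (inj₂ refl) = yz∣x
    sep (inj₂ refl) (inj₁ refl) = C-sym yz∣x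
    sep (inj₂ refl) (inj₂ refl) = C-refl (C⇒≢ʳ yz∣x)

  singleton-∣∣-triple : ∀ {x y z w} → C x y z → C x y w → C x z w →
                        _∣∣_ 𝕃 (⟦_⟧₁ 𝕃 x) (⟦_,_,_⟧₃ 𝕃 y z w)
  singleton-∣∣-triple {x} {y} {z} {w} yz∣x yw∣x zw∣x = singleton-∣∣ sep
    where
    sep : ∀ {b b′} → b ≡ y ⊎ b ≡ z ⊎ b ≡ w → b′ ≡ y ⊎ b′ ≡ z ⊎ b′ ≡ w → C x b b′
    sep (inj₁ refl)        (inj₁ refl)        = C-refl (C⇒≢ˡ yz∣x)
    sep (inj₁ refl)        (inj₂ (inj₁ refl)) = yz∣x
    sep (inj₁ refl)        (inj₂ (inj₂ refl)) = yw∣x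
    sep (inj₂ (inj₁ refl)) (inj₁ refl)        = C-sym yz∣x
    sep (inj₂ (inj₁ refl)) (inj₂ (inj₁ refl)) = C-refl (C⇒≢ʳ yz∣x)
    sep (inj₂ (inj₁ refl)) (inj₂ (inj₂ refl)) = zw∣x
    sep (inj₂ (inj₂ refl)) (inj₁ refl)        = C-sym yw∣x
    sep (inj₂ (inj₂ refl)) (inj₂ (inj₁ refl)) = C-sym zw∣x
    sep (inj₂ (inj₂ refl)) (inj₂ (inj₂ refl)) = C-refl (C⇒≢ʳ yw∣x)

module BehavesAsRerProperties
  (𝕃 : LStructure) (c : LStructure.Carrier 𝕃) (A : Pred 𝕃)
  (A∌c : ∀ a → A a → a ≢ c) (f : LStructure.Carrier 𝕃 → LStructure.Carrier 𝕃)
  (rer : BehavesAsRer 𝕃 f c A) where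
  open LStructure 𝕃
  open CProperties 𝕃
  open BehavesAsRer rer

  c≢ : ∀ {a} → A a → c ≢ a
  c≢ {a} Aa c≡a = A∌c a Aa (sym c≡a)

  ∈A∩S : ∀ {a v} → A v → C c a v → _∩_ 𝕃 A (S 𝕃 c a) v
  ∈A∩S {v = v} Av av∣c = Av , A∌c v Av , av∣c

  ∈A∩S-self : ∀ {a} → A a → _∩_ 𝕃 A (S 𝕃 c a) a
  ∈A∩S-self Aa = ∈A∩S Aa (C-refl (c≢ Aa))

  image : ∀ {a v} → A v → C c a v → Img 𝕃 f (_∩_ 𝕃 A (S 𝕃 c a)) (f v)
  image {v = v} Av av∣c = v , ∈A∩S Av av∣c , refl

  image-self : ∀ {a} → A a → Img 𝕃 f (_∩_ 𝕃 A (S 𝕃 c a)) (f a)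
  image-self Aa = image Aa (C-refl (c≢ Aa))

  f-C-c : ∀ {a b} → A a → A b → C c a b → C (f c) (f a) (f b)
  f-C-c {a} Aa Ab ab∣c =
    proj₂ (rer1 a Aa (f c) (f c) _ _ refl refl (image-self Aa) (image Ab ab∣c))

  f-c-apart : ∀ {a} → A a → C (f a) (f c) (f c)
  f-c-apart {a} Aa =
    proj₁ (rer1 a Aa (f c) (f c) _ _ refl refl (image-self Aa) (image-self Aa))

  f-C-other-branch : ∀ {x y z} → A x → A y → A z → C c x y → ¬ C c x z →
                     C (f z) (f x) (f y)
  f-C-other-branch {x} {y} {z} Ax Ay Az xy∣c ¬xz∣c with rer3 x z Ax Az
  ... | inj₁ Sx≈Sz = ⊥-elim (¬xz∣c (proj₂ (proj₂ (Sx≈Sz z) (A∌c z Az , C-refl (c≢ Az)))))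
  ... | inj₂ apart =
    proj₁ (apart _ _ _ _ (image-self Ax) (image Ay xy∣c) (image-self Az) (image-self Az))

  f-C-below : ∀ {x y z} → A x → A y → A z → C c x y → C z x y → C (f z) (f x) (f y)
  f-C-below {x} {y} {z} Ax Ay Az xy∣c xy∣z with C? c x z
  ... | yes xz∣c = rer2 x Ax z x y (∈A∩S Az xz∣c) (∈A∩S-self Ax) (∈A∩S Ay xy∣c) xy∣z
  ... | no ¬xz∣c = f-C-other-branch Ax Ay Az xy∣c ¬xz∣c

  f-C-above-path : ∀ {u w z} → A u → A w → A z → C u w c → C u z c → C w z c →
                   C (f z) (f u) (f w) × C (f c) (f u) (f w)
  f-C-above-path {u} {w} {z} Au Aw Az wc∣u zc∣u zc∣w
    with rer4 u w z Au Aw Az (singleton-∣∣-triple (C-nest wc∣u zc∣w) wc∣u zc∣u)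
                             (singleton-∣∣-pair zc∣w)
  ... | uwz∣c , uw∣z =
    proj₁ (uw∣z (f u) (f w) (f z) (f z) (inj₁ refl) (inj₂ refl) refl refl) ,
    proj₁ (uwz∣c (f u) (f w) (f c) (f c) (inj₁ refl) (inj₂ (inj₁ refl)) refl refl)

  f-C-above : ∀ {u w z} → A u → A w → A z → C u z c → C w z c →
              C (f z) (f u) (f w) × C (f c) (f u) (f w)
  f-C-above {u} {w} {z} Au Aw Az zc∣u zc∣w with C? c u w
  ... | yes uw∣c = f-C-other-branch Au Aw Az uw∣c (C-asym (C-sym zc∣u)) , f-C-c Au Aw uw∣c
  ... | no ¬uw∣c with u ≟ w
  ...   | yes refl = ⊥-elim (¬uw∣c (C-refl (c≢ Au)))
  ...   | no u≢w with C-binary u≢w (A∌c w Aw) (A∌c u Au)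
  ...     | inj₁ wc∣u = f-C-above-path Au Aw Az wc∣u zc∣u zc∣w
  ...     | inj₂ (inj₁ uc∣w) =
    let (wu∣z , wu∣c) = f-C-above-path Aw Au Az uc∣w zc∣w zc∣u in C-sym wu∣z , C-sym wu∣c
  ...     | inj₂ (inj₂ uw∣c) = ⊥-elim (¬uw∣c uw∣c)

  A∪c : Pred 𝕃
  A∪c x = A x ⊎ x ≡ c

  f-Q-ending-in-c : ∀ {a₁ a₂ a₃} → A∪c a₁ → A∪c a₂ → A∪c a₃ → Q 𝕃 a₁ a₂ a₃ c →
                    Q 𝕃 (f a₁) (f a₂) (f a₃) (f c)
  f-Q-ending-in-c (inj₂ refl) _ _ (inj₁ (_ , h)) = ⊥-elim (C-irreflˡ h)
  f-Q-ending-in-c (inj₂ refl) _ _ (inj₂ (h , _)) = ⊥-elim (C-irreflʳ h)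
  f-Q-ending-in-c _ (inj₂ refl) _ (inj₁ (_ , h)) = ⊥-elim (C-irreflʳ h)
  f-Q-ending-in-c _ (inj₂ refl) _ (inj₂ (_ , h)) = ⊥-elim (C-irreflʳ h)
  f-Q-ending-in-c (inj₁ A₁) (inj₁ A₂) (inj₂ refl) (inj₁ (_ , a₁a₂∣c)) =
    inj₁ (f-C-c A₁ A₂ a₁a₂∣c , f-C-c A₁ A₂ a₁a₂∣c)
  f-Q-ending-in-c (inj₁ A₁) (inj₁ A₂) (inj₂ refl) (inj₂ _) =
    inj₂ (f-c-apart A₁ , f-c-apart A₂)
  f-Q-ending-in-c (inj₁ A₁) (inj₁ A₂) (inj₁ A₃) (inj₁ (a₁a₂∣a₃ , a₁a₂∣c)) =
    inj₁ (f-C-below A₁ A₂ A₃ a₁a₂∣c a₁a₂∣a₃ , f-C-c A₁ A₂ a₁a₂∣c)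
  f-Q-ending-in-c (inj₁ A₁) (inj₁ A₂) (inj₁ A₃) (inj₂ (a₃c∣a₁ , a₃c∣a₂)) =
    inj₁ (f-C-above A₁ A₂ A₃ a₃c∣a₁ a₃c∣a₂)

  -- Unless a₁a₂|c, every x with a₁a₂|x satisfies a₁c|x and a₂c|x: the situation of f-C-above.
  f-C-in-A : ∀ {a₁ a₂ a₃ a₄} → A a₁ → A a₂ → A a₃ → A a₄ → C a₃ a₁ a₂ → C a₄ a₁ a₂ →
             Q 𝕃 (f a₁) (f a₂) (f a₃) (f a₄)
  f-C-in-A {a₁} {a₂} A₁ A₂ A₃ A₄ a₁a₂∣a₃ a₁a₂∣a₄ with C? c a₁ a₂
  ... | yes a₁a₂∣c = inj₁ (f-C-below A₁ A₂ A₃ a₁a₂∣c a₁a₂∣a₃ , f-C-below A₁ A₂ A₄ a₁a₂∣c a₁a₂∣a₄)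
  ... | no ¬a₁a₂∣c =
    inj₂ (proj₁ (f-C-above A₃ A₄ A₁ (a₁c∣ a₁a₂∣a₃) (a₁c∣ a₁a₂∣a₄)) ,
          proj₁ (f-C-above A₃ A₄ A₂ (a₂c∣ a₁a₂∣a₃) (a₂c∣ a₁a₂∣a₄)))
    where
    a₁c∣ : ∀ {x} → C x a₁ a₂ → C x a₁ c
    a₁c∣ a₁a₂∣x with C-trans c (C-sym a₁a₂∣x)
    ... | inj₁ ca₁∣x  = C-sym ca₁∣x
    ... | inj₂ a₂a₁∣c = ⊥-elim (¬a₁a₂∣c (C-sym a₂a₁∣c))
    a₂c∣ : ∀ {x} → C x a₁ a₂ → C x a₂ c
    a₂c∣ a₁a₂∣x with C-trans c a₁a₂∣x
    ... | inj₁ a₂c∣x  = C-sym a₂c∣x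
    ... | inj₂ a₁a₂∣c = ⊥-elim (¬a₁a₂∣c a₁a₂∣c)

  f-preservesQ : PreservesQ 𝕃 f A∪c
  f-preservesQ _ _ _ _ p₁ p₂ p₃ (inj₂ refl) q = f-Q-ending-in-c p₁ p₂ p₃ q
  f-preservesQ _ _ _ _ p₁ p₂ (inj₂ refl) (inj₁ A₄) q =
    Q-swapʳ (f-Q-ending-in-c p₁ p₂ (inj₁ A₄) (Q-swapʳ q))
  f-preservesQ _ _ _ _ (inj₂ refl) p₂ (inj₁ A₃) (inj₁ A₄) q =
    Q-flip (Q-swapʳ (f-Q-ending-in-c (inj₁ A₃) (inj₁ A₄) p₂ (Q-swapʳ (Q-flip q))))
  f-preservesQ _ _ _ _ (inj₁ A₁) (inj₂ refl) (inj₁ A₃) (inj₁ A₄) q =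
    Q-flip (f-Q-ending-in-c (inj₁ A₃) (inj₁ A₄) (inj₁ A₁) (Q-flip q))
  f-preservesQ _ _ _ _ (inj₁ A₁) (inj₁ A₂) (inj₁ A₃) (inj₁ A₄) (inj₁ (a₁a₂∣a₃ , a₁a₂∣a₄)) =
    f-C-in-A A₁ A₂ A₃ A₄ a₁a₂∣a₃ a₁a₂∣a₄
  f-preservesQ _ _ _ _ (inj₁ A₁) (inj₁ A₂) (inj₁ A₃) (inj₁ A₄) (inj₂ (a₃a₄∣a₁ , a₃a₄∣a₂)) =
    Q-flip (f-C-in-A A₃ A₄ A₁ A₂ a₃a₄∣a₁ a₃a₄∣a₂)

mainTheorem11 : (𝕃 : LStructure) → let open LStructure 𝕃 in
    (c : Carrier) (A : Pred 𝕃) → (∀ a → A a → a ≢ c) →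
    (f : Carrier → Carrier) → BehavesAsRer 𝕃 f c A →
    PreservesQ 𝕃 f (λ x → A x ⊎ x ≡ c)
mainTheorem11 𝕃 c A A∌c f rer = BehavesAsRerProperties.f-preservesQ 𝕃 c A A∌c f rer
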